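{- Let $n \ge 3$. The sequence $\{1, 1, L(1), L(2), \ldots, L(n-2)\}$ (the Lucas sequence shifted two places right) is a minimizing $0$-ordered sequence of size $n$ for the elongated binary tree in the class $M_{n,0}$; that is, it belongs to $M_{n,0}$ and its Huffman cost is at most that of every sequence in $M_{n,0}$.
   Context: $L(i)$ denotes the $i$-th Lucas number: $L(1)=1$, $L(2)=3$, $L(i)=L(i-1)+L(i-2)$ for $i>2$. A (strictly) binary tree is an ordered rooted tree in which every non-leaf node has exactly two children; its size is its number of leaves. A binary tree is elongated if among any two sibling nodes at least one is a leaf. For a binary tree $T$ with positive weights $p_1,\dots,p_n$ at its leaves, the weighted external path length is $E(T,P)=\sum_{i=1}^n l_i p_i$, where $l_i$ is the length of the path from the root to leaf $i$. Huffman algorithm on a non-decreasing sequence $P=\{p_1,\dots,p_n\}$ of positive integers: set $P^{(0)}=P$; for $i=1,\dots,n-1$, $P^{(i)}=\{p^{(i)}_1,\dots,p^{(i)}_{n-i}\}$ is obtained from $P^{(i-1)}$ by replacing its two smallest entries $p^{(i-1)}_1,p^{(i-1)}_2$ by their sum and sorting non-decreasingly; the merges define a Huffman tree of $P$, which minimizes $E(T,P)$ over binary trees with leaf weights $P$ (the Huffman cost). A non-decreasing sequence $P$ of $n$ positive integers is $k$-ordered if $p^{(i)}_2 = p^{(i)}_3$ for $i=0,\dots,k$ and $p^{(i)}_2 < p^{(i)}_3$ for $i=k+1,\dots,n-3$. $M_{n,k}$ denotes the set of all $k$-ordered sequences of size $n$ for which an elongated binary tree of size $n$ is a Huffman tree.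 A sequence $P_{\min}\in M$ is minimizing for the tree $T$ in a class $M$ if $E(T,P_{\min})\le E(T,P)$ for all $P\in M$. -}

module Defs where

open import Data.Nat using (ℕ; zero; suc; _+_; _*_; _∸_; _≤_; _<_; _≤ᵇ_)
open import Data.Bool using (if_then_else_)
open import Data.List using (List; []; _∷_; map; upTo; length)
open import Data.List.Relation.Unary.All using (All)
open import Data.List.Relation.Unary.Linked using (Linked)
open import Data.List.Relation.Binary.Permutation.Propositional using (_↭_)
open import Data.Product using (Σ; _×_; ∃)
open import Data.Sum using (_⊎_)
open import Relation.Binary.PropositionalEquality using (_≡_)

-- Lucas numbers: lucas 1 = 1, lucas 2 = 3, lucas (i) = lucas (i-1) + lucas (i-2)
-- (lucas 0 = 2 is the standard value, only used to make the recursion total)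
lucas : ℕ → ℕ
lucas zero = 2
lucas (suc zero) = 1
lucas (suc (suc n)) = lucas (suc n) + lucas n

shiftedLucas : ℕ → List ℕ
shiftedLucas n = 1 ∷ 1 ∷ map (λ i → lucas (suc i)) (upTo (n ∸ 2))

ins : ℕ → List ℕ → List ℕ
ins x [] = x ∷ []
ins x (y ∷ ys) = if x ≤ᵇ y then x ∷ y ∷ ys else y ∷ ins x ys

hstep : List ℕ → List ℕ
hstep (a ∷ b ∷ rest) = ins (a + b) rest
hstep xs = xs

iter : ℕ → List ℕ → List ℕ
iter zero xs = xs
iter (suc i) xs = iter i (hstep xs)

-- p_2 = p_3 (1-based) and p_2 < p_3
Eq23 : List ℕ → Set
Eq23 (_ ∷ b ∷ c ∷ _) = b ≡ c
Eq23 _ = Data.Empty.⊥ where import Data.Empty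

Lt23 : List ℕ → Set
Lt23 (_ ∷ b ∷ c ∷ _) = b < c
Lt23 _ = Data.Empty.⊥ where import Data.Empty

SortedPos : List ℕ → Set
SortedPos P = Linked _≤_ P × All (λ p → 1 ≤ p) P

KOrdered : ℕ → ℕ → List ℕ → Set
KOrdered n k P =
  length P ≡ n × SortedPos P
  × (∀ i → i ≤ k → Eq23 (iter i P))
  × (∀ i → k < i → i ≤ n ∸ 3 → Lt23 (iter i P))

data Tree : Set where
  leaf : ℕ → Tree
  node : Tree → Tree → Tree

IsLeaf : Tree → Set
IsLeaf (leaf _) = Data.Unit.⊤ where import Data.Unit
IsLeaf (node _ _) = Data.Empty.⊥ where import Data.Empty

Elongated : Tree → Set
Elongated (leaf _) = Data.Unit.⊤ where import Data.Unit
Elongated (node l r) = (IsLeaf l ⊎ IsLeaf r) × Elongated l × Elongated r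

weight : Tree → ℕ
weight (leaf w) = w
weight (node l r) = weight l + weight r

epl : ℕ → Tree → ℕ
epl d (leaf w) = d * w
epl d (node l r) = epl (suc d) l + epl (suc d) r

-- weighted external path length E(T,P) (weights stored at the leaves)
E : Tree → ℕ
E T = epl 0 T

-- Each step merges the two first (smallest) trees into a new node (children in
-- either order) and re-sorts the forest (any tie-breaking allowed).
data HRun : List Tree → Tree → Set where
  done : ∀ t → HRun (t ∷ []) t
  step : ∀ {t₁ t₂ rest u forest t} →
         (u ≡ node t₁ t₂ ⊎ u ≡ node t₂ t₁) →
         forest ↭ (u ∷ rest) →
         Linked _≤_ (map weight forest) →
         HRun forest t →
         HRun (t₁ ∷ t₂ ∷ rest) t

HuffmanTree : List ℕ → Tree → Set
HuffmanTree P T = HRun (map leaf P) T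

M : ℕ → ℕ → List ℕ → Set
M n k P = KOrdered n k P × ∃ (λ T → Elongated T × HuffmanTree P T)

-- After its first merge, a Huffman run producing an elongated tree keeps a forest of one
-- tree and leaves, and that tree absorbs the remaining weights l₁ ≤ l₂ ≤ … in order:
-- with s₀ = p₁ + p₂ and sᵢ = sᵢ₋₁ + lᵢ one needs sᵢ₋₁ ≤ lᵢ₊₁, and the cost is s₀ + s₁ + …
-- (the same for every Huffman tree, as a forest sorted by weight is determined by its weights).
-- Being 0-ordered makes this sᵢ₋₁ < lᵢ₊₁ (and lᵢ < lᵢ₊₁). The shifted Lucas sequence starts
-- from the least values s₀ = 2, l₁ = 1 and has lᵢ₊₁ = sᵢ₋₁ + 1 throughout, so every partial
-- sum sᵢ, and hence the cost, is minimal.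

module Submission where

open import Defs
open import Data.Nat using (ℕ; zero; suc; _+_; _*_; _∸_; _≤_; _<_; _≤ᵇ_; z≤n; s≤s)
open import Data.Nat.Properties
  using ( ≤-refl; ≤-trans; ≤-reflexive; <⇒≤; <⇒≱; ≤-<-trans; <-trans; ≤-<-connex
        ; +-comm; +-identityʳ; +-suc; +-mono-≤; m≤m+n; m<m+n; suc-injective
        ; ≤⇒≤ᵇ; ≤ᵇ⇒≤; ≤-totalOrder; ≤-decTotalOrder; +-commutativeSemigroup; module ≤-Reasoning)
open import Algebra.Properties.CommutativeSemigroup +-commutativeSemigroup using (interchange)
open import Data.Nat.Solver using (module +-*-Solver)
open import Data.Nat.ListAction using (sum)
open import Data.Nat.ListAction.Properties using (sum-↭)
open import Data.Bool using (true; false)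
open import Data.List using (List; []; _∷_; map; length; applyUpTo)
open import Data.List.Properties using (map-∘; map-id; map-applyUpTo; length-map)
open import Data.List.Relation.Unary.All using (All; []; _∷_)
open import Data.List.Relation.Unary.Any using (here; there)
open import Data.List.Relation.Unary.Linked using ([]; [-]; _∷_; tail)
open import Data.List.Relation.Unary.Sorted.TotalOrder ≤-totalOrder using (Sorted)
open import Data.List.Relation.Unary.Sorted.TotalOrder.Properties using (↗↭↗⇒≋)
open import Data.List.Relation.Binary.Pointwise using (Pointwise-≡⇒≡)
open import Data.List.Membership.Propositional using (_∈_)
open import Data.List.Relation.Binary.Permutation.Propositional
  using (_↭_; swap; ↭-refl; ↭-sym; ↭-trans; ↭⇒↭ₛ)
open import Data.List.Relation.Binary.Permutation.Propositional.Properties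
  using (∈-resp-↭; drop-∷; ↭-length; map⁺; ↭-map-inv)
open import Data.List.Sort.InsertionSort.Base ≤-decTotalOrder using (insert)
open import Data.List.Sort.InsertionSort.Properties ≤-decTotalOrder using (insert-↭; insert-↗)
open import Data.Product using (∃; ∃₂; _×_; _,_; proj₁; proj₂)
open import Data.Sum using (_⊎_; inj₁; inj₂) renaming (swap to ⊎-swap)
open import Data.Unit using (⊤; tt)
open import Function using (_∘_; id; _⇔_; mk⇔; Equivalence)
open import Relation.Nullary using (¬_; contradiction)
open import Relation.Binary.PropositionalEquality
  using (_≡_; refl; sym; trans; cong; cong₂; subst; subst₂; module ≡-Reasoning)

ins≡insert : ∀ x ys → ins x ys ≡ insert x ys
ins≡insert x [] = refl
ins≡insert x (y ∷ ys) rewrite ins≡insert x ys = refl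

ins-↭ : ∀ x ys → ins x ys ↭ x ∷ ys
ins-↭ x ys rewrite ins≡insert x ys = insert-↭ x ys

ins-↗ : ∀ x {ys} → Sorted ys → Sorted (ins x ys)
ins-↗ x {ys} ys↗ rewrite ins≡insert x ys = insert-↗ x ys↗

ins-≤ : ∀ {x y} ys → x ≤ y → ins x (y ∷ ys) ≡ x ∷ y ∷ ys
ins-≤ {x} {y} ys x≤y with x ≤ᵇ y | ≤⇒≤ᵇ x≤y
... | true  | _  = refl
... | false | ()

ins-> : ∀ {x y} ys → y < x → ins x (y ∷ ys) ≡ y ∷ ins x ys
ins-> {x} {y} ys y<x with x ≤ᵇ y | ≤ᵇ⇒≤ x y
... | false | _   = refl
... | true  | x≤y = contradiction (x≤y tt) (<⇒≱ y<x)

_≤head_ : ℕ → List ℕ → Set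
s ≤head []      = ⊤
s ≤head (l ∷ _) = s ≤ l

ins-≤head : ∀ {s} L → s ≤head L → ins s L ≡ s ∷ L
ins-≤head []      _   = refl
ins-≤head (l ∷ L) s≤l = ins-≤ L s≤l

ins-two-smallest : ∀ {s l} L → s ≤head L →
  (s ≤ l × ins s (l ∷ L) ≡ s ∷ l ∷ L) ⊎ (l < s × ins s (l ∷ L) ≡ l ∷ s ∷ L)
ins-two-smallest {s} {l} L s≤L with ≤-<-connex s l
... | inj₁ s≤l = inj₁ (s≤l , ins-≤ L s≤l)
... | inj₂ l<s = inj₂ (l<s , trans (ins-> L l<s) (cong (l ∷_) (ins-≤head L s≤L)))

hstep-ins : ∀ {s l} L → s ≤head L → hstep (ins s (l ∷ L)) ≡ ins (s + l) L
hstep-ins {s} {l} L s≤L with ins-two-smallest {l = l} L s≤L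
... | inj₁ (_ , eq) rewrite eq = refl
... | inj₂ (_ , eq) rewrite eq = cong (λ x → ins x L) (+-comm l s)

lt23-ins⇔ : ∀ {s l l′} L → s ≤ l′ → Lt23 (ins s (l ∷ l′ ∷ L)) ⇔ (s < l′ × l < l′)
lt23-ins⇔ {l = l} L s≤l′ with ins-two-smallest {l = l} (_ ∷ L) s≤l′
... | inj₁ (s≤l , eq) rewrite eq = mk⇔ (λ l<l′ → ≤-<-trans s≤l l<l′ , l<l′) (λ (_ , l<l′) → l<l′)
... | inj₂ (l<s , eq) rewrite eq = mk⇔ (λ s<l′ → s<l′ , <-trans l<s s<l′) (λ (s<l′ , _) → s<l′)

↗↭↗⇒≡ : ∀ {xs ys} → Sorted xs → Sorted ys → xs ↭ ys → xs ≡ ys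
↗↭↗⇒≡ xs↗ ys↗ xs↭ys = Pointwise-≡⇒≡ (↗↭↗⇒≋ ≤-totalOrder xs↗ ys↗ (↭⇒↭ₛ xs↭ys))

↗⇒≤head : ∀ {x xs} → Sorted (x ∷ xs) → x ≤head xs
↗⇒≤head [-]       = tt
↗⇒≤head (x≤y ∷ _) = x≤y

≤head⇒↗ : ∀ {x xs} → x ≤head xs → Sorted xs → Sorted (x ∷ xs)
≤head⇒↗ {xs = []}    _   _   = [-]
≤head⇒↗ {xs = _ ∷ _} x≤y xs↗ = x≤y ∷ xs↗

↗-skip : ∀ {x y zs} → Sorted (x ∷ y ∷ zs) → Sorted (x ∷ zs)
↗-skip (_ ∷ [-])           = [-]
↗-skip (x≤y ∷ (y≤z ∷ zs↗)) = ≤-trans x≤y y≤z ∷ zs↗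

-- The fuel is the length of the list, one more than the number of merges.
huffmanCost : ℕ → List ℕ → ℕ
huffmanCost (suc f) (a ∷ b ∷ r) = a + b + huffmanCost f (ins (a + b) r)
huffmanCost _       _           = 0

Merged : Tree → Tree → Tree → Set
Merged u t₁ t₂ = u ≡ node t₁ t₂ ⊎ u ≡ node t₂ t₁

merged-weight : ∀ {u t₁ t₂} → Merged u t₁ t₂ → weight u ≡ weight t₁ + weight t₂
merged-weight                 (inj₁ refl) = refl
merged-weight {t₁ = t₁} {t₂} (inj₂ refl) = +-comm (weight t₂) (weight t₁)

epl-suc : ∀ d t → epl (suc d) t ≡ epl d t + weight t
epl-suc d (leaf w)   = +-comm w (d * w)
epl-suc d (node l r) = begin
  epl (suc (suc d)) l + epl (suc (suc d)) r
    ≡⟨ cong₂ _+_ (epl-suc (suc d) l) (epl-suc (suc d) r) ⟩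
  (epl (suc d) l + weight l) + (epl (suc d) r + weight r)
    ≡⟨ interchange (epl (suc d) l) (weight l) (epl (suc d) r) (weight r) ⟩
  (epl (suc d) l + epl (suc d) r) + (weight l + weight r) ∎
  where open ≡-Reasoning

E-node : ∀ a b → E (node a b) ≡ E a + E b + (weight a + weight b)
E-node a b = trans (cong₂ _+_ (epl-suc 0 a) (epl-suc 0 b)) (interchange (E a) (weight a) (E b) (weight b))

merged-E : ∀ {u t₁ t₂} → Merged u t₁ t₂ → E u ≡ E t₁ + E t₂ + (weight t₁ + weight t₂)
merged-E {t₁ = t₁} {t₂} (inj₁ refl) = E-node t₁ t₂
merged-E {t₁ = t₁} {t₂} (inj₂ refl) =
  trans (E-node t₂ t₁) (cong₂ _+_ (+-comm (E t₂) (E t₁)) (+-comm (weight t₂) (weight t₁)))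

map-weight-leaves : ∀ P → map weight (map leaf P) ≡ P
map-weight-leaves P = trans (sym (map-∘ P)) (map-id P)

leaves-↭ : ∀ {P Q} → map leaf P ↭ map leaf Q → P ↭ Q
leaves-↭ {P} {Q} p = subst₂ _↭_ (map-weight-leaves P) (map-weight-leaves Q) (map⁺ weight p)

E-run : ∀ {F t} → HRun F t → Sorted (map weight F) →
  E t ≡ sum (map E F) + huffmanCost (length F) (map weight F)
E-run (done t) _ = sym (trans (+-identityʳ _) (+-identityʳ _))
E-run (step {t₁} {t₂} {rest} {u} {forest} {t} e p forest↗ run) F↗ = begin
  E t
    ≡⟨ E-run run forest↗ ⟩
  sum (map E forest) + huffmanCost (length forest) (map weight forest)
    ≡⟨ cong₂ _+_ (sum-↭ (map⁺ E p)) (cong₂ huffmanCost (↭-length p) forest-weights) ⟩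
  E u + sum (map E rest) + huffmanCost (suc (length rest)) (ins (weight u) (map weight rest))
    ≡⟨ cong₂ (λ x w → x + sum (map E rest) + huffmanCost (suc (length rest)) (ins w (map weight rest)))
             (merged-E e) (merged-weight e) ⟩
  E t₁ + E t₂ + w₁₂ + sum (map E rest) + huffmanCost (suc (length rest)) (ins w₁₂ (map weight rest))
    ≡⟨ solve 5 (λ a b w r h → a :+ b :+ w :+ r :+ h := a :+ (b :+ r) :+ (w :+ h)) refl
         (E t₁) (E t₂) w₁₂ (sum (map E rest)) (huffmanCost (suc (length rest)) (ins w₁₂ (map weight rest))) ⟩
  sum (map E (t₁ ∷ t₂ ∷ rest)) + huffmanCost (length (t₁ ∷ t₂ ∷ rest)) (map weight (t₁ ∷ t₂ ∷ rest)) ∎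
  where
  open ≡-Reasoning
  open +-*-Solver using (solve; _:+_; _:=_)
  w₁₂ = weight t₁ + weight t₂
  forest-weights : map weight forest ≡ ins (weight u) (map weight rest)
  forest-weights = ↗↭↗⇒≡ forest↗ (ins-↗ (weight u) (tail (tail F↗)))
    (↭-trans (map⁺ weight p) (↭-sym (ins-↭ (weight u) (map weight rest))))

sum-E-leaves : ∀ P → sum (map E (map leaf P)) ≡ 0
sum-E-leaves []      = refl
sum-E-leaves (_ ∷ P) = sum-E-leaves P

huffmanTree-cost : ∀ {P T} → Sorted P → HuffmanTree P T → E T ≡ huffmanCost (length P) P
huffmanTree-cost {P} P↗ h =
  trans (E-run h (subst Sorted (sym (map-weight-leaves P)) P↗))
    (cong₂ _+_ (sum-E-leaves P) (cong₂ huffmanCost (length-map leaf P) (map-weight-leaves P)))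

-- Chains: one tree absorbing the leaves in order

Chain : ℕ → List ℕ → Set
Chain s []      = ⊤
Chain s (l ∷ L) = s ≤head L × Chain (s + l) L

chainCost : ℕ → List ℕ → ℕ
chainCost s []      = 0
chainCost s (l ∷ L) = s + l + chainCost (s + l) L

huffmanCost-chain : ∀ s L → Chain s L → huffmanCost (suc (length L)) (ins s L) ≡ chainCost s L
huffmanCost-chain s []      _          = refl
huffmanCost-chain s (l ∷ L) (s≤L , ch) with ins-two-smallest {l = l} L s≤L
... | inj₁ (_ , eq) rewrite eq              = cong (s + l +_) (huffmanCost-chain (s + l) L ch)
... | inj₂ (_ , eq) rewrite eq | +-comm l s = cong (s + l +_) (huffmanCost-chain (s + l) L ch)

huffmanTree-chainCost : ∀ {p₁ p₂ L T} → Sorted (p₁ ∷ p₂ ∷ L) → Chain (p₁ + p₂) L →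
  HuffmanTree (p₁ ∷ p₂ ∷ L) T → E T ≡ p₁ + p₂ + chainCost (p₁ + p₂) L
huffmanTree-chainCost {p₁} {p₂} {L} P↗ ch h =
  trans (huffmanTree-cost P↗ h) (cong (p₁ + p₂ +_) (huffmanCost-chain (p₁ + p₂) L ch))

-- Huffman runs that produce elongated trees

∈-leaves⇒IsLeaf : ∀ {v R} → v ∈ map leaf R → IsLeaf v
∈-leaves⇒IsLeaf {R = _ ∷ _} (here refl) = tt
∈-leaves⇒IsLeaf {R = _ ∷ _} (there v∈) = ∈-leaves⇒IsLeaf v∈

nonleaf-∷-↭ : ∀ {v u xs R} → ¬ IsLeaf v → v ∷ xs ↭ u ∷ map leaf R → v ≡ u × xs ↭ map leaf R
nonleaf-∷-↭ v≢leaf p with ∈-resp-↭ p (here refl)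
... | here refl = refl , drop-∷ p
... | there v∈  = contradiction (∈-leaves⇒IsLeaf v∈) v≢leaf

merged-nonleaf : ∀ {u t₁ t₂} → Merged u t₁ t₂ → ¬ IsLeaf u
merged-nonleaf (inj₁ refl) ()
merged-nonleaf (inj₂ refl) ()

merged-elongated : ∀ {u t₁ t₂} → Merged u t₁ t₂ → Elongated u →
  (IsLeaf t₁ ⊎ IsLeaf t₂) × Elongated t₁ × Elongated t₂
merged-elongated (inj₁ refl) (oneLeaf , el₁ , el₂) = oneLeaf , el₁ , el₂
merged-elongated (inj₂ refl) (oneLeaf , el₂ , el₁) = ⊎-swap oneLeaf , el₁ , el₂

data FrontPair (u : Tree) (l : ℕ) : Tree → Tree → Set where
  tree-first : FrontPair u l u (leaf l)
  leaf-first : FrontPair u l (leaf l) u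

front-pair : ∀ t₁ t₂ → IsLeaf t₁ ⊎ IsLeaf t₂ → ∃₂ λ u l → FrontPair u l t₁ t₂
front-pair t₁         (leaf l)   _        = t₁ , l , tree-first
front-pair (leaf l)   (node a b) _        = node a b , l , leaf-first
front-pair (node _ _) (node _ _) (inj₁ ())
front-pair (node _ _) (node _ _) (inj₂ ())

front-pair-by-weight : ∀ {u l L} → weight u ≤head L → Sorted (l ∷ L) →
  ∃₂ λ t₁ t₂ → FrontPair u l t₁ t₂ × Sorted (weight t₁ ∷ weight t₂ ∷ L)
front-pair-by-weight {u} {l} u≤L lL↗ with ≤-<-connex (weight u) l
... | inj₁ u≤l = u , leaf l , tree-first , u≤l ∷ lL↗
... | inj₂ l<u = leaf l , u , leaf-first , <⇒≤ l<u ∷ ≤head⇒↗ u≤L (tail lL↗)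

front-pair-↭ : ∀ {u l t₁ t₂ xs} → FrontPair u l t₁ t₂ → t₁ ∷ t₂ ∷ xs ↭ u ∷ leaf l ∷ xs
front-pair-↭ tree-first = ↭-refl
front-pair-↭ leaf-first = swap _ _ ↭-refl

front-pair-weight : ∀ {u l t₁ t₂} → FrontPair u l t₁ t₂ → weight t₁ + weight t₂ ≡ weight u + l
front-pair-weight         tree-first = refl
front-pair-weight {u} {l} leaf-first = +-comm l (weight u)

front-pair-merged : ∀ {u l t₁ t₂} → FrontPair u l t₁ t₂ → Merged (node u (leaf l)) t₁ t₂
front-pair-merged tree-first = inj₁ refl
front-pair-merged leaf-first = inj₂ refl

front-pair-tree : ∀ {u l t₁ t₂} (P : Tree → Set) → FrontPair u l t₁ t₂ → P t₁ → P t₂ → P u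
front-pair-tree P tree-first p₁ _  = p₁
front-pair-tree P leaf-first _  p₂ = p₂

front-pair-↗ : ∀ {u l t₁ t₂ R} → FrontPair u l t₁ t₂ → Sorted (weight t₁ ∷ weight t₂ ∷ R) →
  weight u ≤head R × Sorted (l ∷ R)
front-pair-↗ tree-first ↗ = ↗⇒≤head (↗-skip ↗) , tail ↗
front-pair-↗ leaf-first ↗ = ↗⇒≤head (tail ↗) , ↗-skip ↗

ElongatedForest : List Tree → Set
ElongatedForest F = ∃₂ λ u R → Elongated u × F ↭ u ∷ map leaf R

elongated-step : ∀ {v t₁ t₂ forest rest} → Merged v t₁ t₂ → forest ↭ v ∷ rest →
  ElongatedForest forest →
  ∃₂ λ u l → ∃ λ R → FrontPair u l t₁ t₂ × Elongated u × rest ≡ map leaf R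
elongated-step e p (w , R , elw , q) with nonleaf-∷-↭ (merged-nonleaf e) (↭-trans (↭-sym p) q)
... | refl , rest↭ with merged-elongated e elw | ↭-map-inv leaf (↭-sym rest↭)
... | oneLeaf , el₁ , el₂ | R′ , refl , _ with front-pair _ _ oneLeaf
... | u , l , fp = u , l , R′ , fp , front-pair-tree Elongated fp el₁ el₂ , refl

elongated-forest : ∀ {F t} → HRun F t → Elongated t → ElongatedForest F
elongated-forest (done t) el = t , [] , el , ↭-refl
elongated-forest (step e p _ run) el with elongated-step e p (elongated-forest run el)
... | u , l , R , fp , elu , refl = u , l ∷ R , elu , front-pair-↭ fp

elongated-run⇒chain : ∀ {F t u L} → HRun F t → Elongated t → Sorted (map weight F) →
  F ↭ u ∷ map leaf L → ¬ IsLeaf u → Sorted L → Chain (weight u) L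
elongated-run⇒chain {L = []} (done _) _ _ _ _ _ = tt
elongated-run⇒chain {L = _ ∷ _} (done _) _ _ F↭ _ _ with ↭-length F↭
... | ()
-- u is the only non-leaf, so it is merged first together with some leaf l, and sortedness
-- forces L = l ∷ R.
elongated-run⇒chain (step e p forest↗ run) el F↗ F↭ u≢leaf L↗
  with elongated-step e p (elongated-forest run el)
... | _ , l , R , fp , _ , refl with nonleaf-∷-↭ u≢leaf (↭-trans (↭-sym F↭) (front-pair-↭ fp))
... | refl , L↭ with front-pair-↗ fp (subst (λ X → Sorted (_ ∷ _ ∷ X)) (map-weight-leaves R) F↗)
... | u≤R , lR↗ with ↗↭↗⇒≡ L↗ lR↗ (leaves-↭ L↭)
... | refl = u≤R , subst (λ s → Chain s R) (trans (merged-weight e) (front-pair-weight fp))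
                     (elongated-run⇒chain run el forest↗ p (merged-nonleaf e) (tail lR↗))

elongated-huffman⇒chain : ∀ {p₁ p₂ L T} → Sorted (p₁ ∷ p₂ ∷ L) →
  HuffmanTree (p₁ ∷ p₂ ∷ L) T → Elongated T → Chain (p₁ + p₂) L
elongated-huffman⇒chain {L = L} P↗ (step e p forest↗ run) el =
  subst (λ s → Chain s L) (merged-weight e)
    (elongated-run⇒chain run el forest↗ p (merged-nonleaf e) (tail (tail P↗)))

chain⇒elongated-run : ∀ {u L} → Elongated u → Chain (weight u) L → Sorted L →
  ∃₂ λ F t → F ↭ u ∷ map leaf L × Sorted (map weight F) × Elongated t × HRun F t
chain⇒elongated-run {u} {[]} elu _ _ = u ∷ [] , u , ↭-refl , [-] , elu , done u
chain⇒elongated-run {u} {l ∷ L} elu (u≤L , ch) lL↗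
  with chain⇒elongated-run {node u (leaf l)} (inj₂ tt , elu , tt) ch (tail lL↗)
... | F , t , F↭ , F↗ , elt , run with front-pair-by-weight {u} u≤L lL↗
... | t₁ , t₂ , fp , ↗₁₂ =
  t₁ ∷ t₂ ∷ map leaf L , t , front-pair-↭ fp ,
  subst (λ X → Sorted (_ ∷ _ ∷ X)) (sym (map-weight-leaves L)) ↗₁₂ ,
  elt , step (front-pair-merged fp) F↭ F↗ run

chain⇒elongated-huffman : ∀ {p₁ p₂ L} → Sorted (p₁ ∷ p₂ ∷ L) → Chain (p₁ + p₂) L →
  ∃ λ T → Elongated T × HuffmanTree (p₁ ∷ p₂ ∷ L) T
chain⇒elongated-huffman {p₁} {p₂} P↗ ch
  with chain⇒elongated-run {node (leaf p₁) (leaf p₂)} (inj₁ tt , tt , tt) ch (tail (tail P↗))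
... | _ , t , F↭ , F↗ , elt , run = t , elt , step (inj₁ refl) F↭ F↗ run

-- Strict chains and the 0-ordered condition

StrictChain : ℕ → List ℕ → Set
StrictChain s (l ∷ l′ ∷ L) = s < l′ × l < l′ × StrictChain (s + l) (l′ ∷ L)
StrictChain _ _            = ⊤

strictChain⇒chain : ∀ s L → StrictChain s L → Chain s L
strictChain⇒chain s []           _                = tt
strictChain⇒chain s (l ∷ [])     _                = tt , tt
strictChain⇒chain s (l ∷ l′ ∷ L) (s<l′ , _ , st) = <⇒≤ s<l′ , strictChain⇒chain (s + l) (l′ ∷ L) st

strictChain⇒lt23 : ∀ s L → StrictChain s L → ∀ j → j < length L ∸ 1 → Lt23 (iter j (ins s L))
strictChain⇒lt23 s (l ∷ l′ ∷ L) (s<l′ , l<l′ , _) zero _ =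
  Equivalence.from (lt23-ins⇔ L (<⇒≤ s<l′)) (s<l′ , l<l′)
strictChain⇒lt23 s (l ∷ l′ ∷ L) (s<l′ , _ , st) (suc j) (s≤s j<) =
  subst (λ X → Lt23 (iter j X)) (sym (hstep-ins (l′ ∷ L) (<⇒≤ s<l′)))
    (strictChain⇒lt23 (s + l) (l′ ∷ L) st j j<)

lt23⇒strictChain : ∀ s L → Chain s L → (∀ j → j < length L ∸ 1 → Lt23 (iter j (ins s L))) →
  StrictChain s L
lt23⇒strictChain s []           _           _  = tt
lt23⇒strictChain s (l ∷ [])     _           _  = tt
lt23⇒strictChain s (l ∷ l′ ∷ L) (s≤l′ , ch) lt =
  s<l′ , l<l′ , lt23⇒strictChain (s + l) (l′ ∷ L) ch λ j j< →
    subst (λ X → Lt23 (iter j X)) (hstep-ins (l′ ∷ L) s≤l′) (lt (suc j) (s≤s j<))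
  where
  front = Equivalence.to (lt23-ins⇔ L s≤l′) (lt 0 (s≤s z≤n))
  s<l′ = proj₁ front
  l<l′ = proj₂ front

Tight : ℕ → List ℕ → Set
Tight s (q ∷ q′ ∷ Q) = q′ ≡ suc s × Tight (s + q) (q′ ∷ Q)
Tight _ _            = ⊤

tight-chainCost-≤ : ∀ {s′ s q l} Q L → s′ ≤ s → q ≤ l → Tight s′ (q ∷ Q) → StrictChain s (l ∷ L) →
  length Q ≡ length L → chainCost s′ (q ∷ Q) ≤ chainCost s (l ∷ L)
tight-chainCost-≤ []       []       s′≤s q≤l _ _ _ = +-mono-≤ (+-mono-≤ s′≤s q≤l) z≤n
tight-chainCost-≤ (_ ∷ Q) (_ ∷ L) s′≤s q≤l (refl , tight) (s<l′ , _ , strict) len =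
  +-mono-≤ sq≤sl (tight-chainCost-≤ Q L sq≤sl (≤-trans (s≤s s′≤s) s<l′) tight strict (suc-injective len))
  where sq≤sl = +-mono-≤ s′≤s q≤l

lucasFrom : ℕ → ℕ → List ℕ
lucasFrom k zero    = []
lucasFrom k (suc m) = lucas (suc k) ∷ lucasFrom (suc k) m

applyUpTo-lucas : ∀ (f : ℕ → ℕ) k m → (∀ i → f i ≡ lucas (suc (k + i))) → applyUpTo f m ≡ lucasFrom k m
applyUpTo-lucas f k zero    _  = refl
applyUpTo-lucas f k (suc m) f≗ =
  cong₂ _∷_ (trans (f≗ 0) (cong (lucas ∘ suc) (+-identityʳ k)))
    (applyUpTo-lucas (f ∘ suc) (suc k) m λ i → trans (f≗ (suc i)) (cong (lucas ∘ suc) (+-suc k i)))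

shiftedLucas≡lucasFrom : ∀ m → shiftedLucas (3 + m) ≡ 1 ∷ 1 ∷ lucasFrom 0 (suc m)
shiftedLucas≡lucasFrom m = cong (λ L → 1 ∷ 1 ∷ L)
  (trans (map-applyUpTo id (lucas ∘ suc) (suc m)) (applyUpTo-lucas (lucas ∘ suc) 0 (suc m) λ _ → refl))

0<lucas : ∀ k → 0 < lucas k
0<lucas zero          = s≤s z≤n
0<lucas (suc zero)    = s≤s z≤n
0<lucas (suc (suc k)) = ≤-trans (0<lucas (suc k)) (m≤m+n _ _)

lucasFrom-length : ∀ k m → length (lucasFrom k m) ≡ m
lucasFrom-length k zero    = refl
lucasFrom-length k (suc m) = cong suc (lucasFrom-length (suc k) m)

lucasFrom-↗ : ∀ k m → Sorted (lucasFrom k m)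
lucasFrom-↗ k zero          = []
lucasFrom-↗ k (suc zero)    = [-]
lucasFrom-↗ k (suc (suc m)) = m≤m+n (lucas (suc k)) (lucas k) ∷ lucasFrom-↗ (suc k) (suc m)

lucasFrom-positive : ∀ k m → All (1 ≤_) (lucasFrom k m)
lucasFrom-positive k zero    = []
lucasFrom-positive k (suc m) = 0<lucas (suc k) ∷ lucasFrom-positive (suc k) m

-- 2 + L(1) + ... + L(k) = L(k+2) - 1, so the Lucas sequence meets every s < l′ with equality.
lucasFrom-tight : ∀ k m {s} → suc s ≡ lucas (suc (suc k)) → Tight s (lucasFrom k m)
lucasFrom-tight k zero          _  = tt
lucasFrom-tight k (suc zero)    _  = tt
lucasFrom-tight k (suc (suc m)) eq = sym eq , lucasFrom-tight (suc k) (suc m) (cong (_+ lucas (suc k)) eq)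

lucasFrom-strict : ∀ k m {s} → suc s ≡ lucas (suc (suc k)) → StrictChain s (lucasFrom k m)
lucasFrom-strict k zero          _  = tt
lucasFrom-strict k (suc zero)    _  = tt
lucasFrom-strict k (suc (suc m)) eq =
  ≤-reflexive eq , m<m+n (lucas (suc k)) (0<lucas k) ,
  lucasFrom-strict (suc k) (suc m) (cong (_+ lucas (suc k)) eq)

M⇒strictChain : ∀ {n p₁ p₂ L} → M n 0 (p₁ ∷ p₂ ∷ L) → StrictChain (p₁ + p₂) L
M⇒strictChain {L = L} ((refl , (P↗ , _) , _ , lt23) , _ , el , h) =
  lt23⇒strictChain _ L (elongated-huffman⇒chain P↗ h el) λ j j< → lt23 (suc j) (s≤s z≤n) j<

lucas-M : ∀ m → M (3 + m) 0 (1 ∷ 1 ∷ lucasFrom 0 (suc m))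
lucas-M m =
  ( cong (2 +_) (lucasFrom-length 0 (suc m))
  , (P↗ , s≤s z≤n ∷ s≤s z≤n ∷ lucasFrom-positive 0 (suc m))
  , eq23 , lt23 )
  , chain⇒elongated-huffman P↗ (strictChain⇒chain 2 _ (lucasFrom-strict 0 (suc m) refl))
  where
  P↗ : Sorted (1 ∷ 1 ∷ lucasFrom 0 (suc m))
  P↗ = ≤-refl ∷ ≤-refl ∷ lucasFrom-↗ 0 (suc m)
  eq23 : ∀ i → i ≤ 0 → Eq23 (iter i (1 ∷ 1 ∷ lucasFrom 0 (suc m)))
  eq23 .0 z≤n = refl
  lt23 : ∀ i → 0 < i → i ≤ m → Lt23 (iter i (1 ∷ 1 ∷ lucasFrom 0 (suc m)))
  lt23 (suc j) _ j< = strictChain⇒lt23 2 _ (lucasFrom-strict 0 (suc m) refl) j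
    (subst (suc j ≤_) (sym (lucasFrom-length 1 m)) j<)

lucas-cost-≤ : ∀ m {P T₁ T₂} → HuffmanTree (1 ∷ 1 ∷ lucasFrom 0 (suc m)) T₁ →
  M (3 + m) 0 P → HuffmanTree P T₂ → E T₁ ≤ E T₂
lucas-cost-≤ m {p₁ ∷ p₂ ∷ l ∷ L} {T₁} {T₂} h₁ P∈M@((len , (P↗ , 1≤p₁ ∷ 1≤p₂ ∷ 1≤l ∷ _) , _) , _) h₂ =
  begin
    E T₁
      ≡⟨ huffmanTree-chainCost (≤-refl ∷ ≤-refl ∷ lucasFrom-↗ 0 (suc m)) lucas-chain h₁ ⟩
    2 + chainCost 2 (lucasFrom 0 (suc m))
      ≤⟨ +-mono-≤ 2≤p₁+p₂ (tight-chainCost-≤ (lucasFrom 1 m) L 2≤p₁+p₂ 1≤l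
           (lucasFrom-tight 0 (suc m) refl) P-strict lengths) ⟩
    p₁ + p₂ + chainCost (p₁ + p₂) (l ∷ L)
      ≡⟨ huffmanTree-chainCost P↗ (strictChain⇒chain _ _ P-strict) h₂ ⟨
    E T₂
  ∎
  where
  open ≤-Reasoning
  lucas-chain = strictChain⇒chain 2 _ (lucasFrom-strict 0 (suc m) refl)
  P-strict = M⇒strictChain P∈M
  2≤p₁+p₂ = +-mono-≤ 1≤p₁ 1≤p₂
  lengths : length (lucasFrom 1 m) ≡ length L
  lengths = trans (lucasFrom-length 1 m) (suc-injective (suc-injective (suc-injective (sym len))))

corollary1 : (n : ℕ) → 3 ≤ n →
    M n 0 (shiftedLucas n) ×
    (∀ T₁ → HuffmanTree (shiftedLucas n) T₁ →
      ∀ (P : List ℕ) → M n 0 P → ∀ T₂ → HuffmanTree P T₂ → E T₁ ≤ E T₂)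
corollary1 (suc (suc (suc m))) (s≤s (s≤s (s≤s _))) =
  subst (λ Q → M (3 + m) 0 Q × (∀ T₁ → HuffmanTree Q T₁ →
                 ∀ (P : List ℕ) → M (3 + m) 0 P → ∀ T₂ → HuffmanTree P T₂ → E T₁ ≤ E T₂))
    (sym (shiftedLucas≡lucasFrom m))
    (lucas-M m , λ _ h₁ _ P∈M _ h₂ → lucas-cost-≤ m h₁ P∈M h₂)
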